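{- If $X$ is a short game, then there exists a Digraph placement game $G$ such that $G=X$. (That is, the ruleset Digraph placement is universal.)
   Context: All games are short normal-play two-player combinatorial games (Left and Right; no chance or hidden information, bounded length of play, finitely many options at every position, a player unable to move on their turn loses). Equality $Y=Z$ means that for every game $X$ the disjunctive sums $X+Y$ and $X+Z$ (in which each move is made in exactly one component) have the same outcome. A Digraph placement game is played on a finite digraph $G=(V,E)$ with a (not necessarily proper) colouring $V\to\{\text{blue},\text{red}\}$: on her turn Left chooses a remaining blue vertex $v$ and deletes $v$ together with all its out-neighbours; on his turn Right does the same with a remaining red vertex. A player unable to move loses. -}

module Defs where

open import Data.Nat using (ℕ; zero; suc; _+_)
open import Data.Fin using (Fin; splitAt; _≟_)
open import Data.Bool using (Bool; true; false; not; _∧_; _∨_)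
open import Data.Sum using ([_,_])
open import Data.Product using (_×_; _,_)
open import Data.List using (List; filter; length; lookup)
open import Data.List.Base using (allFin)
open import Relation.Nullary.Decidable using (⌊_⌋; does)
open import Relation.Binary.PropositionalEquality using (_≡_)

data Game : Set where
  mk : (nl : ℕ) → (Fin nl → Game) → (nr : ℕ) → (Fin nr → Game) → Game

append : {A : Set} {m n : ℕ} → (Fin m → A) → (Fin n → A) → Fin (m + n) → A
append {m = m} f g i = [ f , g ] (splitAt m i)

_⊕_ : Game → Game → Game
mk gnl gl gnr gr ⊕ mk hnl hl hnr hr =
  mk (gnl + hnl)
     (append (λ i → gl i ⊕ mk hnl hl hnr hr) (λ j → mk gnl gl gnr gr ⊕ hl j))
     (gnr + hnr)
     (append (λ i → gr i ⊕ mk hnl hl hnr hr) (λ j → mk gnl gl gnr gr ⊕ hr j))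

anyF : (n : ℕ) → (Fin n → Bool) → Bool
anyF zero    f = false
anyF (suc n) f = f Fin.zero ∨ anyF n (λ i → f (Fin.suc i))


-- normal play: a player unable to move loses
mutual
  leftWinsFirst : Game → Bool
  leftWinsFirst (mk nl gl nr gr) = anyF nl (λ i → not (rightWinsFirst (gl i)))

  rightWinsFirst : Game → Bool
  rightWinsFirst (mk nl gl nr gr) = anyF nr (λ i → not (leftWinsFirst (gr i)))

outcome : Game → Bool × Bool
outcome G = leftWinsFirst G , rightWinsFirst G

_≈g_ : Game → Game → Set
Y ≈g Z = ∀ (X : Game) → outcome (X ⊕ Y) ≡ outcome (X ⊕ Z)

data Colour : Set where
  blue red : Colour

isBlue isRed : Colour → Bool
isBlue blue = true
isBlue red  = false
isRed  blue = false
isRed  red  = true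

record Digraph : Set where
  field
    n      : ℕ
    arc    : Fin n → Fin n → Bool
    colour : Fin n → Colour

module _ (D : Digraph) where
  open Digraph D

  Remaining : Set
  Remaining = Fin n → Bool

  delete : Remaining → Fin n → Remaining
  delete S v w = S w ∧ not (does (w ≟ v)) ∧ not (arc v w)

  -- game value of a position; the fuel k only needs to bound the number
  -- of remaining vertices (every move deletes at least one vertex), and
  -- initially k = n suffices.
  position : ℕ → Remaining → Game
  position zero    S = mk 0 (λ ()) 0 (λ ())
  position (suc k) S =
    mk (length L) (λ i → position k (delete S (lookup L i)))
       (length R) (λ i → position k (delete S (lookup R i)))
    where
      L = filter (λ v → S v ∧ isBlue (colour v) Data.Bool.≟ true) (allFin n)
      R = filter (λ v → S v ∧ isRed  (colour v) Data.Bool.≟ true) (allFin n)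

digraphGame : Digraph → Game
digraphGame D = position D (Digraph.n D) (λ _ → true)

-- Realise every option by a digraph and take the disjoint union of these
-- components, together with one entry vertex per option, coloured for the player owning the option and
-- deleting every component but its own: playing it moves exactly to that option. All other moves are made
-- bad by four classes g₀, g₁, g₂, g₃ of size(X) + 1 guard vertices, which delete everything except guards.
-- Whatever other vertex a player takes, the opponent answers with a guard after which only at least size(X)
-- independent vertices of the opponent's colour remain; such a position is ≤ X (for Right) or ≥ X (for Left).
-- Hence the digraph game is both ≤ X and ≥ X, and ≤ is compatible with sums.

module Submission where

open import Defs
open import Data.Product using (Σ-syntax)

open import Data.Bool as Bool using (Bool; true; false; not; _∧_; if_then_else_)
open import Data.Bool.Properties using (not-injective; ⇔→≡; ∧-zeroʳ)
open import Data.Empty using (⊥-elim)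
open import Data.Fin as Fin using (Fin; _≟_; splitAt; _↑ˡ_; _↑ʳ_)
open import Data.Fin.Properties using (splitAt-↑ˡ; splitAt-↑ʳ; suc-injective; 0≢1+n; +↔⊎; *↔×)
open import Data.List using (List; filter; lookup; allFin)
open import Data.List.Membership.Propositional.Properties using (∈-filter⁺; ∈-filter⁻; ∈-lookup; ∈-allFin)
open import Data.List.Relation.Unary.Any as Any using ()
open import Data.List.Relation.Unary.Any.Properties using (lookup-index)
open import Data.Nat using (ℕ; zero; suc; _+_; _*_; _≤_; _<_; z≤n; s≤s)
open import Data.Nat.Properties using (≤-refl; ≤-trans; ≤-pred; <-≤-trans; n≮0; m≤m+n; m≤n+m; n≤1+n)
open import Data.Product using (Σ; _×_; _,_; proj₁; proj₂; ∃-syntax)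
open import Data.Product.Function.NonDependent.Propositional using (_×-↔_)
open import Data.Sum using (_⊎_; inj₁; inj₂)
open import Data.Sum.Function.Propositional using (_⊎-↔_)
open import Data.Vec.Functional using (foldr)
open import Function.Bundles using (_↔_; mk↔ₛ′; Inverse; mk⇔)
open import Function.Properties.Inverse using (↔-refl; ↔-sym; ↔-trans)
open import Relation.Binary.PropositionalEquality using (_≡_; _≢_; refl; sym; trans; cong; cong₂; subst)
open import Relation.Nullary using (Dec; yes; no; does)

nL nR : Game → ℕ
nL (mk nl _ _ _) = nl
nR (mk _ _ nr _) = nr

gL : (G : Game) → Fin (nL G) → Game
gL (mk _ gl _ _) = gl

gR : (G : Game) → Fin (nR G) → Game
gR (mk _ _ _ gr) = gr

-- Conway's order: G ⧏ H (G is less than or confused with H) is ¬ H ≼ G, defined positively.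
infix 4 _≼_ _⧏_ _≋_
mutual
  data _≼_ (G H : Game) : Set where
    le : (∀ i → gL G i ⧏ H) → (∀ j → G ⧏ gR H j) → G ≼ H

  data _⧏_ (G H : Game) : Set where
    lfL : ∀ j → G ≼ gL H j → G ⧏ H
    lfR : ∀ i → gR G i ≼ H → G ⧏ H

_≋_ : Game → Game → Set
G ≋ H = G ≼ H × H ≼ G

≼-refl : ∀ G → G ≼ G
≼-refl (mk _ gl _ gr) = le (λ i → lfL i (≼-refl (gl i))) (λ j → lfR j (≼-refl (gr j)))

mutual
  ≼-trans : ∀ {G H K} → G ≼ H → H ≼ K → G ≼ K
  ≼-trans G≼H@(le G<H _) H≼K@(le _ K>H) =
    le (λ i → ⧏-≼-trans (G<H i) H≼K) (λ j → ≼-⧏-trans G≼H (K>H j))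

  ⧏-≼-trans : ∀ {G H K} → G ⧏ H → H ≼ K → G ⧏ K
  ⧏-≼-trans (lfL j G≼Hj) (le Hj<K _) = ≼-⧏-trans G≼Hj (Hj<K j)
  ⧏-≼-trans (lfR i Gi≼H) H≼K         = lfR i (≼-trans Gi≼H H≼K)

  ≼-⧏-trans : ∀ {G H K} → G ≼ H → H ⧏ K → G ⧏ K
  ≼-⧏-trans G≼H          (lfL j H≼Kj) = lfL j (≼-trans G≼H H≼Kj)
  ≼-⧏-trans (le _ Hi>G) (lfR i Hi≼K) = ⧏-≼-trans (Hi>G i) Hi≼K

≋-sym : ∀ {G H} → G ≋ H → H ≋ G
≋-sym (G≼H , H≼G) = H≼G , G≼H

≋-trans : ∀ {G H K} → G ≋ H → H ≋ K → G ≋ K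
≋-trans (G≼H , H≼G) (H≼K , K≼H) = ≼-trans G≼H H≼K , ≼-trans K≼H H≼G

append-↑ˡ : ∀ {A : Set} {m n} (f : Fin m → A) (g : Fin n → A) i → append f g (i ↑ˡ n) ≡ f i
append-↑ˡ {m = m} {n} f g i rewrite splitAt-↑ˡ m i n = refl

append-↑ʳ : ∀ {A : Set} {m n} (f : Fin m → A) (g : Fin n → A) j → append f g (m ↑ʳ j) ≡ g j
append-↑ʳ {m = m} {n} f g j rewrite splitAt-↑ʳ m n j = refl

append-All : ∀ {A : Set} {m n} (P : A → Set) {f : Fin m → A} {g : Fin n → A} →
             (∀ i → P (f i)) → (∀ j → P (g j)) → ∀ k → P (append f g k)
append-All {m = m} P Pf Pg k with splitAt m k
... | inj₁ i = Pf i
... | inj₂ j = Pg j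

mutual
  ⊕-monoʳ-≼ : ∀ X {G H} → G ≼ H → X ⊕ G ≼ X ⊕ H
  ⊕-monoʳ-≼ X@(mk _ xl _ xr) {G@(mk _ _ _ _)} {H@(mk hnl hl hnr hr)} G≼H@(le G<H H>G) =
    le (append-All (_⧏ X ⊕ H)
          (λ i → lfL (i ↑ˡ hnl) (subst (xl i ⊕ G ≼_) (sym (append-↑ˡ _ (λ j → X ⊕ hl j) i))
                                  (⊕-monoʳ-≼ (xl i) G≼H)))
          (λ j → ⊕-monoʳ-⧏ X (G<H j)))
       (append-All (X ⊕ G ⧏_)
          (λ i → lfR (i ↑ˡ _) (subst (_≼ xr i ⊕ H) (sym (append-↑ˡ _ _ i)) (⊕-monoʳ-≼ (xr i) G≼H)))
          (λ j → ⊕-monoʳ-⧏ X (H>G j)))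

  ⊕-monoʳ-⧏ : ∀ X {G H} → G ⧏ H → X ⊕ G ⧏ X ⊕ H
  ⊕-monoʳ-⧏ X@(mk xnl xl _ _) {G@(mk _ _ _ _)} {H@(mk _ hl _ _)} (lfL j G≼Hj) =
    lfL (xnl ↑ʳ j) (subst (X ⊕ G ≼_) (sym (append-↑ʳ (λ i → xl i ⊕ H) (λ j → X ⊕ hl j) j))
                     (⊕-monoʳ-≼ X G≼Hj))
  ⊕-monoʳ-⧏ X@(mk _ _ xnr xr) {G@(mk _ _ _ gr)} {H@(mk _ _ _ _)} (lfR i Gi≼H) =
    lfR (xnr ↑ʳ i) (subst (_≼ X ⊕ H) (sym (append-↑ʳ (λ j → xr j ⊕ G) (λ i → X ⊕ gr i) i))
                     (⊕-monoʳ-≼ X Gi≼H))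

𝟘 : Game
𝟘 = mk 0 (λ ()) 0 (λ ())

anyF-true⁻ : ∀ n f → anyF n f ≡ true → ∃[ i ] f i ≡ true
anyF-true⁻ (suc n) f e with f Fin.zero in f0
... | true  = Fin.zero , f0
... | false with anyF-true⁻ n (λ i → f (Fin.suc i)) e
...   | i , fi = Fin.suc i , fi

anyF-true⁺ : ∀ n f i → f i ≡ true → anyF n f ≡ true
anyF-true⁺ (suc n) f Fin.zero    fi rewrite fi = refl
anyF-true⁺ (suc n) f (Fin.suc i) fi with f Fin.zero
... | true  = refl
... | false = anyF-true⁺ n (λ i → f (Fin.suc i)) i fi

anyF-false⁻ : ∀ n f → anyF n f ≡ false → ∀ i → f i ≡ false
anyF-false⁻ n f e i with f i in fi
... | false = refl
... | true  = trans (sym (anyF-true⁺ n f i fi)) e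

anyF-false⁺ : ∀ n f → (∀ i → f i ≡ false) → anyF n f ≡ false
anyF-false⁺ zero    f _  = refl
anyF-false⁺ (suc n) f ff rewrite ff Fin.zero = anyF-false⁺ n (λ i → f (Fin.suc i)) (λ i → ff (Fin.suc i))

mutual
  leftWinsFirst⇒𝟘⧏ : ∀ G → leftWinsFirst G ≡ true → 𝟘 ⧏ G
  leftWinsFirst⇒𝟘⧏ (mk nl gl _ _) e with anyF-true⁻ nl _ e
  ... | i , wins = lfL i (rightLosesFirst⇒𝟘≼ (gl i) (not-injective wins))

  rightLosesFirst⇒𝟘≼ : ∀ G → rightWinsFirst G ≡ false → 𝟘 ≼ G
  rightLosesFirst⇒𝟘≼ (mk _ _ nr gr) e =
    le (λ ()) (λ j → leftWinsFirst⇒𝟘⧏ (gr j) (not-injective (anyF-false⁻ nr _ e j)))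

mutual
  𝟘⧏⇒leftWinsFirst : ∀ G → 𝟘 ⧏ G → leftWinsFirst G ≡ true
  𝟘⧏⇒leftWinsFirst (mk nl gl _ _) (lfL i 𝟘≼Gi) = anyF-true⁺ nl _ i (cong not (𝟘≼⇒rightLosesFirst (gl i) 𝟘≼Gi))

  𝟘≼⇒rightLosesFirst : ∀ G → 𝟘 ≼ G → rightWinsFirst G ≡ false
  𝟘≼⇒rightLosesFirst (mk _ _ nr gr) (le _ Gj>𝟘) =
    anyF-false⁺ nr _ (λ j → cong not (𝟘⧏⇒leftWinsFirst (gr j) (Gj>𝟘 j)))

mutual
  rightWinsFirst⇒⧏𝟘 : ∀ G → rightWinsFirst G ≡ true → G ⧏ 𝟘
  rightWinsFirst⇒⧏𝟘 (mk _ _ nr gr) e with anyF-true⁻ nr _ e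
  ... | j , wins = lfR j (leftLosesFirst⇒≼𝟘 (gr j) (not-injective wins))

  leftLosesFirst⇒≼𝟘 : ∀ G → leftWinsFirst G ≡ false → G ≼ 𝟘
  leftLosesFirst⇒≼𝟘 (mk nl gl _ _) e =
    le (λ i → rightWinsFirst⇒⧏𝟘 (gl i) (not-injective (anyF-false⁻ nl _ e i))) (λ ())

mutual
  ⧏𝟘⇒rightWinsFirst : ∀ G → G ⧏ 𝟘 → rightWinsFirst G ≡ true
  ⧏𝟘⇒rightWinsFirst (mk _ _ nr gr) (lfR j Gj≼𝟘) = anyF-true⁺ nr _ j (cong not (≼𝟘⇒leftLosesFirst (gr j) Gj≼𝟘))

  ≼𝟘⇒leftLosesFirst : ∀ G → G ≼ 𝟘 → leftWinsFirst G ≡ false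
  ≼𝟘⇒leftLosesFirst (mk nl gl _ _) (le Gi<𝟘 _) =
    anyF-false⁺ nl _ (λ i → cong not (⧏𝟘⇒rightWinsFirst (gl i) (Gi<𝟘 i)))

leftWinsFirst-⊕-mono : ∀ X {Y W} → Y ≼ W → leftWinsFirst (X ⊕ Y) ≡ true → leftWinsFirst (X ⊕ W) ≡ true
leftWinsFirst-⊕-mono X Y≼W e = 𝟘⧏⇒leftWinsFirst _ (⧏-≼-trans (leftWinsFirst⇒𝟘⧏ _ e) (⊕-monoʳ-≼ X Y≼W))

rightWinsFirst-⊕-antimono : ∀ X {Y W} → W ≼ Y → rightWinsFirst (X ⊕ Y) ≡ true → rightWinsFirst (X ⊕ W) ≡ true
rightWinsFirst-⊕-antimono X W≼Y e = ⧏𝟘⇒rightWinsFirst _ (≼-⧏-trans (⊕-monoʳ-≼ X W≼Y) (rightWinsFirst⇒⧏𝟘 _ e))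

≋⇒≈g : ∀ {Y W} → Y ≋ W → Y ≈g W
≋⇒≈g (Y≼W , W≼Y) X = cong₂ _,_
  (⇔→≡ (mk⇔ (leftWinsFirst-⊕-mono X Y≼W) (leftWinsFirst-⊕-mono X W≼Y)))
  (⇔→≡ (mk⇔ (rightWinsFirst-⊕-antimono X W≼Y) (rightWinsFirst-⊕-antimono X Y≼W)))

∑ : ∀ {n} → (Fin n → ℕ) → ℕ
∑ = foldr _+_ 0

≤-∑ : ∀ {n} (f : Fin n → ℕ) i → f i ≤ ∑ f
≤-∑ f Fin.zero    = m≤m+n (f Fin.zero) _
≤-∑ f (Fin.suc i) = ≤-trans (≤-∑ (λ i → f (Fin.suc i)) i) (m≤n+m _ (f Fin.zero))

size : Game → ℕ
size (mk _ gl _ gr) = suc (∑ (λ i → size (gl i)) + ∑ (λ j → size (gr j)))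

size-gL< : ∀ G i → size (gL G i) < size G
size-gL< (mk _ gl _ gr) i = s≤s (≤-trans (≤-∑ (λ i → size (gl i)) i) (m≤m+n _ _))

size-gR< : ∀ G j → size (gR G j) < size G
size-gR< (mk _ gl _ gr) j = s≤s (≤-trans (≤-∑ (λ j → size (gr j)) j) (m≤n+m _ _))

module _ {n : ℕ} where

  count : (Fin n → Bool) → ℕ
  count S = ∑ (λ v → if S v then 1 else 0)

  infix 4 _⊆_
  _⊆_ : (Fin n → Bool) → (Fin n → Bool) → Set
  S′ ⊆ S = ∀ v → S′ v ≡ true → S v ≡ true

count≤n : ∀ {n} (S : Fin n → Bool) → count S ≤ n
count≤n {zero}  S = z≤n
count≤n {suc n} S with S Fin.zero
... | true  = s≤s (count≤n (λ v → S (Fin.suc v)))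
... | false = ≤-trans (count≤n (λ v → S (Fin.suc v))) (n≤1+n n)

count-mono : ∀ {n} {S′ S : Fin n → Bool} → S′ ⊆ S → count S′ ≤ count S
count-mono {zero}          S′⊆S = z≤n
count-mono {suc n} {S′} {S} S′⊆S with S′ Fin.zero in e′ | S Fin.zero in e
... | true  | true  = s≤s (count-mono λ v → S′⊆S (Fin.suc v))
... | true  | false with () ← trans (sym (S′⊆S Fin.zero e′)) e
... | false | true  = ≤-trans (count-mono λ v → S′⊆S (Fin.suc v)) (n≤1+n _)
... | false | false = count-mono λ v → S′⊆S (Fin.suc v)

count-< : ∀ {n} {S′ S : Fin n → Bool} v → S′ ⊆ S → S v ≡ true → S′ v ≡ false → count S′ < count S
count-< {S′ = S′} {S} Fin.zero S′⊆S Sv S′v rewrite Sv | S′v = s≤s (count-mono λ v → S′⊆S (Fin.suc v))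
count-< {suc n} {S′} {S} (Fin.suc v) S′⊆S Sv S′v with S′ Fin.zero in e′ | S Fin.zero in e
... | true  | true  = s≤s (count-< v (λ w → S′⊆S (Fin.suc w)) Sv S′v)
... | true  | false with () ← trans (sym (S′⊆S Fin.zero e′)) e
... | false | true  = ≤-trans (count-< v (λ w → S′⊆S (Fin.suc w)) Sv S′v) (n≤1+n _)
... | false | false = count-< v (λ w → S′⊆S (Fin.suc w)) Sv S′v

∧-isBlue⁻ : ∀ b c → b ∧ isBlue c ≡ true → b ≡ true × c ≡ blue
∧-isBlue⁻ true blue _ = refl , refl

∧-isRed⁻ : ∀ b c → b ∧ isRed c ≡ true → b ≡ true × c ≡ red
∧-isRed⁻ true red _ = refl , refl

∧-isBlue⁺ : ∀ {b c} → b ≡ true → c ≡ blue → b ∧ isBlue c ≡ true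
∧-isBlue⁺ refl refl = refl

∧-isRed⁺ : ∀ {b c} → b ≡ true → c ≡ red → b ∧ isRed c ≡ true
∧-isRed⁺ refl refl = refl

module Positions (D : Digraph) where
  open Digraph D

  -- Every fuel k ≥ count S gives the game of S, so its properties are stated for all such k.
  Fuelled : (Game → Set) → Remaining D → Set
  Fuelled P S = ∀ k → count S ≤ k → P (position D k S)

  BlueIn RedIn : Remaining D → Fin n → Set
  BlueIn S v = S v ≡ true × colour v ≡ blue
  RedIn  S v = S v ≡ true × colour v ≡ red

  blueIn? : (S : Remaining D) (v : Fin n) → Dec ((S v ∧ isBlue (colour v)) ≡ true)
  blueIn? S v = S v ∧ isBlue (colour v) Bool.≟ true

  redIn? : (S : Remaining D) (v : Fin n) → Dec ((S v ∧ isRed (colour v)) ≡ true)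
  redIn? S v = S v ∧ isRed (colour v) Bool.≟ true

  leftMoves rightMoves : Remaining D → List (Fin n)
  leftMoves  S = filter (blueIn? S) (allFin n)
  rightMoves S = filter (redIn? S) (allFin n)

  leftMove-BlueIn : ∀ S i → BlueIn S (lookup (leftMoves S) i)
  leftMove-BlueIn S i = ∧-isBlue⁻ _ _ (proj₂ (∈-filter⁻ (blueIn? S) {xs = allFin n} (∈-lookup i)))

  rightMove-RedIn : ∀ S j → RedIn S (lookup (rightMoves S) j)
  rightMove-RedIn S j = ∧-isRed⁻ _ _ (proj₂ (∈-filter⁻ (redIn? S) {xs = allFin n} (∈-lookup j)))

  BlueIn-leftMove : ∀ S v → BlueIn S v → ∃[ i ] lookup (leftMoves S) i ≡ v
  BlueIn-leftMove S v (Sv , v-blue) = Any.index v∈ , sym (lookup-index v∈)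
    where v∈ = ∈-filter⁺ (blueIn? S) (∈-allFin v) (∧-isBlue⁺ Sv v-blue)

  RedIn-rightMove : ∀ S v → RedIn S v → ∃[ j ] lookup (rightMoves S) j ≡ v
  RedIn-rightMove S v (Sv , v-red) = Any.index v∈ , sym (lookup-index v∈)
    where v∈ = ∈-filter⁺ (redIn? S) (∈-allFin v) (∧-isRed⁺ Sv v-red)

  delete-⊆ : ∀ S v → delete D S v ⊆ S
  delete-⊆ S v w e with S w
  ... | true = refl

  delete-self : ∀ S v → delete D S v v ≡ false
  delete-self S v with v ≟ v
  ... | yes _  = ∧-zeroʳ (S v)
  ... | no v≢v = ⊥-elim (v≢v refl)

  delete⁺ : ∀ S {v w} → S w ≡ true → w ≢ v → arc v w ≡ false → delete D S v w ≡ true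
  delete⁺ S {v} {w} Sw w≢v vw with w ≟ v
  ... | yes w≡v = ⊥-elim (w≢v w≡v)
  ... | no _ rewrite Sw | vw = refl

  delete⁻ : ∀ S v w → delete D S v w ≡ true → S w ≡ true × arc v w ≡ false
  delete⁻ S v w e with S w | w ≟ v | arc v w
  delete⁻ S v w () | false | _     | _
  delete⁻ S v w () | true  | yes _ | _
  delete⁻ S v w () | true  | no _  | true
  delete⁻ S v w e  | true  | no _  | false = refl , refl

  count-delete< : ∀ S v → S v ≡ true → count (delete D S v) < count S
  count-delete< S v Sv = count-< v (delete-⊆ S v) Sv (delete-self S v)

  count-delete≤ : ∀ S v {k} → S v ≡ true → count S ≤ suc k → count (delete D S v) ≤ k
  count-delete≤ S v Sv c = ≤-pred (<-≤-trans (count-delete< S v Sv) c)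

  ⧏-leftMove : ∀ {S v G} k → BlueIn S v → G ≼ position D k (delete D S v) → G ⧏ position D (suc k) S
  ⧏-leftMove {S} {v} k Bv G≼Sv with BlueIn-leftMove S v Bv
  ... | i , refl = lfL i G≼Sv

  ⧏-rightMove : ∀ {S v G} k → RedIn S v → position D k (delete D S v) ≼ G → position D (suc k) S ⧏ G
  ⧏-rightMove {S} {v} k Rv Sv≼G with RedIn-rightMove S v Rv
  ... | j , refl = lfR j Sv≼G

  count≤0⇒empty : ∀ {S} → count S ≤ 0 → ∀ v → S v ≢ true
  count≤0⇒empty {S} c v Sv = n≮0 (<-≤-trans (count-delete< S v Sv) c)

  empty-≋𝟘 : ∀ {S} k → (∀ v → S v ≢ true) → position D k S ≋ 𝟘
  empty-≋𝟘     zero    _     = le (λ ()) (λ ()) , le (λ ()) (λ ())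
  empty-≋𝟘 {S} (suc k) empty =
    le (λ i → ⊥-elim (empty _ (proj₁ (leftMove-BlueIn S i)))) (λ ()) ,
    le (λ ()) (λ j → ⊥-elim (empty _ (proj₁ (rightMove-RedIn S j))))

  leftMove-⧏ : ∀ {S H} v → BlueIn S v → Fuelled (H ≼_) (delete D S v) → Fuelled (H ⧏_) S
  leftMove-⧏ v (Sv , _) _    zero    c = ⊥-elim (count≤0⇒empty c v Sv)
  leftMove-⧏ v Bv       H≼Sv (suc k) c = ⧏-leftMove k Bv (H≼Sv k (count-delete≤ _ _ (proj₁ Bv) c))

  rightMove-⧏ : ∀ {S H} v → RedIn S v → Fuelled (_≼ H) (delete D S v) → Fuelled (_⧏ H) S
  rightMove-⧏ v (Sv , _) _    zero    c = ⊥-elim (count≤0⇒empty c v Sv)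
  rightMove-⧏ v Rv       Sv≼H (suc k) c = ⧏-rightMove k Rv (Sv≼H k (count-delete≤ _ _ (proj₁ Rv) c))

  ≼-byMoves : ∀ {S H} → (∀ v → BlueIn S v → Fuelled (_⧏ H) (delete D S v)) →
              (∀ j → Fuelled (_⧏ gR H j) S) → Fuelled (_≼ H) S
  ≼-byMoves     left right zero    c = le (λ ()) (λ j → right j zero c)
  ≼-byMoves {S} left right (suc k) c =
    le (λ i → let Bv = leftMove-BlueIn S i in left _ Bv k (count-delete≤ S _ (proj₁ Bv) c))
       (λ j → right j (suc k) c)

  ≽-byMoves : ∀ {S H} → (∀ i → Fuelled (gL H i ⧏_) S) →
              (∀ v → RedIn S v → Fuelled (H ⧏_) (delete D S v)) → Fuelled (H ≼_) S
  ≽-byMoves     left right zero    c = le (λ i → left i zero c) (λ ())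
  ≽-byMoves {S} left right (suc k) c =
    le (λ i → left i (suc k) c)
       (λ j → let Rv = rightMove-RedIn S j in right _ Rv k (count-delete≤ S _ (proj₁ Rv) c))

  record IndependentIn (S : Remaining D) (h : ℕ) : Set where
    field
      vertex    : Fin h → Fin n
      injective : ∀ {i j} → vertex i ≡ vertex j → i ≡ j
      remains   : ∀ i → S (vertex i) ≡ true
      noArc     : ∀ i j → arc (vertex i) (vertex j) ≡ false

  IndependentIn-deleteFirst : ∀ {S h} (I : IndependentIn S (suc h)) →
                              IndependentIn (delete D S (IndependentIn.vertex I Fin.zero)) h
  IndependentIn-deleteFirst {S} I = record
    { vertex    = λ i → vertex (Fin.suc i)
    ; injective = λ e → suc-injective (injective e)
    ; remains   = λ i → delete⁺ S (remains (Fin.suc i)) (λ e → 0≢1+n (sym (injective e))) (noArc _ _)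
    ; noArc     = λ i j → noArc (Fin.suc i) (Fin.suc j)
    }
    where open IndependentIn I

  -- h independent red vertices form the integer -h, which is ≤ X as soon as h ≥ size X.
  onlyRed-≼ : ∀ X {S h} → size X ≤ h → IndependentIn S h → (∀ w → S w ≡ true → colour w ≡ red) →
              Fuelled (_≼ X) S
  onlyRed-≼ X {S} {suc h} X≤h I allRed = ≼-byMoves noBlue respond
    where
    open IndependentIn I
    noBlue : ∀ v → BlueIn S v → Fuelled (_⧏ X) (delete D S v)
    noBlue v (Sv , v-blue) with () ← trans (sym v-blue) (allRed v Sv)
    respond : ∀ j → Fuelled (_⧏ gR X j) S
    respond j = rightMove-⧏ (vertex Fin.zero) (remains Fin.zero , allRed _ (remains Fin.zero))
      (onlyRed-≼ (gR X j) (≤-pred (≤-trans (size-gR< X j) X≤h)) (IndependentIn-deleteFirst I)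
        (λ w Sw → allRed w (delete-⊆ S _ w Sw)))
  onlyRed-≼ (mk _ _ _ _) {h = zero} ()

  onlyBlue-≽ : ∀ X {S h} → size X ≤ h → IndependentIn S h → (∀ w → S w ≡ true → colour w ≡ blue) →
               Fuelled (X ≼_) S
  onlyBlue-≽ X {S} {suc h} X≤h I allBlue = ≽-byMoves respond noRed
    where
    open IndependentIn I
    noRed : ∀ v → RedIn S v → Fuelled (X ⧏_) (delete D S v)
    noRed v (Sv , v-red) with () ← trans (sym v-red) (allBlue v Sv)
    respond : ∀ i → Fuelled (gL X i ⧏_) S
    respond i = leftMove-⧏ (vertex Fin.zero) (remains Fin.zero , allBlue _ (remains Fin.zero))
      (onlyBlue-≽ (gL X i) (≤-pred (≤-trans (size-gL< X i) X≤h)) (IndependentIn-deleteFirst I)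
        (λ w Sw → allBlue w (delete-⊆ S _ w Sw)))
  onlyBlue-≽ (mk _ _ _ _) {h = zero} ()

module Embedding (D E : Digraph) (f : Fin (Digraph.n E) → Fin (Digraph.n D))
                 (f-injective : ∀ {u u′} → f u ≡ f u′ → u ≡ u′)
                 (f-colour : ∀ u → Digraph.colour D (f u) ≡ Digraph.colour E u)
                 (f-arc : ∀ u u′ → Digraph.arc D (f u) (f u′) ≡ Digraph.arc E u u′) where
  private
    module PD = Positions D
    module PE = Positions E

  record IsImage (SE : Remaining E) (SD : Remaining D) : Set where
    field
      agrees  : ∀ u → SD (f u) ≡ SE u
      inImage : ∀ w → SD w ≡ true → ∃[ u ] f u ≡ w
  open IsImage

  IsImage-delete : ∀ {SE SD} u → IsImage SE SD → IsImage (delete E SE u) (delete D SD (f u))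
  IsImage-delete {SE} {SD} u im = record
    { agrees  = deleted-agrees
    ; inImage = λ w Sw → inImage im w (PD.delete-⊆ SD (f u) w Sw)
    }
    where
    does-f≟f : ∀ u′ → does (f u′ ≟ f u) ≡ does (u′ ≟ u)
    does-f≟f u′ with f u′ ≟ f u | u′ ≟ u
    ... | yes _    | yes _    = refl
    ... | no _     | no _     = refl
    ... | yes fu≡  | no u≢    = ⊥-elim (u≢ (f-injective fu≡))
    ... | no fu≢   | yes refl = ⊥-elim (fu≢ refl)

    deleted-agrees : ∀ u′ → delete D SD (f u) (f u′) ≡ delete E SE u u′
    deleted-agrees u′ rewrite agrees im u′ | does-f≟f u′ | f-arc u u′ = refl

  BlueIn-image : ∀ {SE SD u} → IsImage SE SD → PE.BlueIn SE u → PD.BlueIn SD (f u)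
  BlueIn-image {u = u} im (SEu , blue-u) = trans (agrees im u) SEu , trans (f-colour u) blue-u

  RedIn-image : ∀ {SE SD u} → IsImage SE SD → PE.RedIn SE u → PD.RedIn SD (f u)
  RedIn-image {u = u} im (SEu , red-u) = trans (agrees im u) SEu , trans (f-colour u) red-u

  BlueIn-preimage : ∀ {SE SD u} → IsImage SE SD → PD.BlueIn SD (f u) → PE.BlueIn SE u
  BlueIn-preimage {u = u} im (SDfu , blue-fu) =
    trans (sym (agrees im u)) SDfu , trans (sym (f-colour u)) blue-fu

  RedIn-preimage : ∀ {SE SD u} → IsImage SE SD → PD.RedIn SD (f u) → PE.RedIn SE u
  RedIn-preimage {u = u} im (SDfu , red-fu) =
    trans (sym (agrees im u)) SDfu , trans (sym (f-colour u)) red-fu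

  position-≋ : ∀ kD kE {SD SE} → count SD ≤ kD → count SE ≤ kE → IsImage SE SD →
               position D kD SD ≋ position E kE SE
  position-≋ zero kE cD _ im =
    ≋-trans (PD.empty-≋𝟘 zero (PD.count≤0⇒empty cD))
            (≋-sym (PE.empty-≋𝟘 kE (λ u SEu → PD.count≤0⇒empty cD (f u) (trans (agrees im u) SEu))))
  position-≋ (suc kD) zero {SD} _ cE im =
    ≋-trans (PD.empty-≋𝟘 (suc kD) emptyD) (≋-sym (PE.empty-≋𝟘 zero (PE.count≤0⇒empty cE)))
    where
    emptyD : ∀ w → SD w ≢ true
    emptyD w SDw with inImage im w SDw
    ... | u , refl = PE.count≤0⇒empty cE u (trans (sym (agrees im u)) SDw)
  position-≋ (suc kD) (suc kE) {SD} {SE} cD cE im =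
    le (λ i → leftD (PD.leftMove-BlueIn SD i)) (λ j → rightE (PE.rightMove-RedIn SE j)) ,
    le (λ i → leftE (PE.leftMove-BlueIn SE i)) (λ j → rightD (PD.rightMove-RedIn SD j))
    where
    afterMove : ∀ u → SE u ≡ true → position D kD (delete D SD (f u)) ≋ position E kE (delete E SE u)
    afterMove u SEu = position-≋ kD kE (PD.count-delete≤ SD (f u) (trans (agrees im u) SEu) cD)
                                       (PE.count-delete≤ SE u SEu cE) (IsImage-delete u im)

    leftD : ∀ {v} → PD.BlueIn SD v → position D kD (delete D SD v) ⧏ position E (suc kE) SE
    leftD {v} Bv with inImage im v (proj₁ Bv)
    ... | u , refl = let Bu = BlueIn-preimage im Bv in PE.⧏-leftMove kE Bu (proj₁ (afterMove u (proj₁ Bu)))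

    rightD : ∀ {v} → PD.RedIn SD v → position E (suc kE) SE ⧏ position D kD (delete D SD v)
    rightD {v} Rv with inImage im v (proj₁ Rv)
    ... | u , refl = let Ru = RedIn-preimage im Rv in PE.⧏-rightMove kE Ru (proj₂ (afterMove u (proj₁ Ru)))

    leftE : ∀ {u} → PE.BlueIn SE u → position E kE (delete E SE u) ⧏ position D (suc kD) SD
    leftE {u} Bu = PD.⧏-leftMove kD (BlueIn-image im Bu) (proj₂ (afterMove u (proj₁ Bu)))

    rightE : ∀ {u} → PE.RedIn SE u → position D (suc kD) SD ⧏ position E kE (delete E SE u)
    rightE {u} Ru = PD.⧏-rightMove kD (RedIn-image im Ru) (proj₁ (afterMove u (proj₁ Ru)))

Σ-Fin-suc-↔ : ∀ {m} (P : Fin (suc m) → Set) → Σ (Fin (suc m)) P ↔ (P Fin.zero ⊎ Σ (Fin m) (λ k → P (Fin.suc k)))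
Σ-Fin-suc-↔ P = mk↔ₛ′ to from (λ { (inj₁ _) → refl ; (inj₂ _) → refl })
                              (λ { (Fin.zero , _) → refl ; (Fin.suc _ , _) → refl })
  where
  to : Σ _ P → _
  to (Fin.zero  , p) = inj₁ p
  to (Fin.suc k , p) = inj₂ (k , p)
  from : _ → Σ _ P
  from (inj₁ p)       = Fin.zero , p
  from (inj₂ (k , p)) = Fin.suc k , p

Σ-Fin-↔ : ∀ {m} (ns : Fin m → ℕ) → Σ (Fin m) (λ k → Fin (ns k)) ↔ Fin (∑ ns)
Σ-Fin-↔ {zero}  ns = mk↔ₛ′ (λ ()) (λ ()) (λ ()) (λ ())
Σ-Fin-↔ {suc m} ns =
  ↔-trans (Σ-Fin-suc-↔ (λ k → Fin (ns k)))
          (↔-trans (↔-refl ⊎-↔ Σ-Fin-↔ (λ k → ns (Fin.suc k))) (↔-sym +↔⊎))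

module Enumerated {V : Set} {N : ℕ} (enumeration : V ↔ Fin N)
                  (arcᵛ : V → V → Bool) (colourᵛ : V → Colour) where
  open Inverse enumeration using (strictlyInverseˡ; strictlyInverseʳ) renaming (from to vertexAt)

  index : V → Fin N
  index = Inverse.to enumeration

  digraph : Digraph
  digraph = record
    { n = N ; arc = λ v w → arcᵛ (vertexAt v) (vertexAt w) ; colour = λ v → colourᵛ (vertexAt v) }

  open Digraph digraph
  open Positions digraph public

  index-injective : ∀ {x y} → index x ≡ index y → x ≡ y
  index-injective {x} {y} e = trans (sym (strictlyInverseʳ x)) (trans (cong vertexAt e) (strictlyInverseʳ y))

  colour-index : ∀ x → colour (index x) ≡ colourᵛ x
  colour-index x = cong colourᵛ (strictlyInverseʳ x)

  arc-index : ∀ x y → arc (index x) (index y) ≡ arcᵛ x y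
  arc-index x y rewrite strictlyInverseʳ x | strictlyInverseʳ y = refl

  ∀-index : (P : Fin N → Set) → (∀ x → P (index x)) → ∀ w → P w
  ∀-index P P-index w = subst P (strictlyInverseˡ w) (P-index (vertexAt w))

  deleteᵛ⁺ : ∀ S x y → S (index y) ≡ true → y ≢ x → arcᵛ x y ≡ false →
             delete digraph S (index x) (index y) ≡ true
  deleteᵛ⁺ S x y Sy y≢x xy = delete⁺ S Sy (λ e → y≢x (index-injective e)) (trans (arc-index x y) xy)

  deleteᵛ⁻ : ∀ S x y → delete digraph S (index x) (index y) ≡ true →
             S (index y) ≡ true × arcᵛ x y ≡ false
  deleteᵛ⁻ S x y e with delete⁻ S (index x) (index y) e
  ... | Sy , xy = Sy , trans (sym (arc-index x y)) xy

data Class : Set where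
  g₀ g₁ g₂ g₃ : Class

-- Guard class gᵢ is red for even i and blue for odd i, and kills the classes gᵢ₊₁ and gᵢ₊₂
-- (indices mod 4): after gᵢ is played, the reply gᵢ₋₁ leaves only its own, opposite-coloured class.
classColour : Class → Colour
classColour g₀ = red
classColour g₁ = blue
classColour g₂ = red
classColour g₃ = blue

kills : Class → Class → Bool
kills g₀ g₁ = true
kills g₀ g₂ = true
kills g₁ g₂ = true
kills g₁ g₃ = true
kills g₂ g₃ = true
kills g₂ g₀ = true
kills g₃ g₀ = true
kills g₃ g₁ = true
kills _  _  = false

kills-irrefl : ∀ c → kills c c ≡ false
kills-irrefl g₀ = refl
kills-irrefl g₁ = refl
kills-irrefl g₂ = refl
kills-irrefl g₃ = refl

-- A vertex of a component spares only the guard class its opponent replies from.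
innerKills : Colour → Class → Bool
innerKills blue g₀ = false
innerKills red  g₃ = false
innerKills _    _  = true

innerKills-blue : ∀ c → innerKills blue c ≡ false → c ≡ g₀
innerKills-blue g₀ _ = refl

innerKills-red : ∀ c → innerKills red c ≡ false → c ≡ g₃
innerKills-red g₃ _ = refl

Class↔Fin4 : Class ↔ Fin 4
Class↔Fin4 = mk↔ₛ′ to from
  (λ { Fin.zero → refl ; (Fin.suc Fin.zero) → refl ; (Fin.suc (Fin.suc Fin.zero)) → refl
     ; (Fin.suc (Fin.suc (Fin.suc Fin.zero))) → refl })
  (λ { g₀ → refl ; g₁ → refl ; g₂ → refl ; g₃ → refl })
  where
  to : Class → Fin 4
  to g₀ = Fin.zero
  to g₁ = Fin.suc Fin.zero
  to g₂ = Fin.suc (Fin.suc Fin.zero)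
  to g₃ = Fin.suc (Fin.suc (Fin.suc Fin.zero))
  from : Fin 4 → Class
  from Fin.zero                            = g₀
  from (Fin.suc Fin.zero)                  = g₁
  from (Fin.suc (Fin.suc Fin.zero))        = g₂
  from (Fin.suc (Fin.suc (Fin.suc _)))     = g₃

module Construction {m : ℕ} (side : Fin m → Colour) (Ds : Fin m → Digraph) (K : ℕ) where
  ns : Fin m → ℕ
  ns k = Digraph.n (Ds k)

  data Vertex : Set where
    guard : Class → Fin (suc K) → Vertex
    entry : Fin m → Vertex
    inner : (k : Fin m) → Fin (ns k) → Vertex

  Vertex↔⊎ : Vertex ↔ ((Class × Fin (suc K)) ⊎ (Fin m ⊎ Σ (Fin m) (λ k → Fin (ns k))))
  Vertex↔⊎ = mk↔ₛ′ to from
    (λ { (inj₁ _) → refl ; (inj₂ (inj₁ _)) → refl ; (inj₂ (inj₂ _)) → refl })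
    (λ { (guard _ _) → refl ; (entry _) → refl ; (inner _ _) → refl })
    where
    to : Vertex → _
    to (guard c t) = inj₁ (c , t)
    to (entry k)   = inj₂ (inj₁ k)
    to (inner k u) = inj₂ (inj₂ (k , u))
    from : _ → Vertex
    from (inj₁ (c , t))        = guard c t
    from (inj₂ (inj₁ k))       = entry k
    from (inj₂ (inj₂ (k , u))) = inner k u

  enumeration : Vertex ↔ Fin (4 * suc K + (m + ∑ ns))
  enumeration = ↔-trans Vertex↔⊎ (↔-trans
    ((↔-trans (Class↔Fin4 ×-↔ ↔-refl) (↔-sym *↔×)) ⊎-↔ (↔-trans (↔-refl ⊎-↔ Σ-Fin-↔ ns) (↔-sym +↔⊎)))
    (↔-sym +↔⊎))

  colourᵛ : Vertex → Colour
  colourᵛ (guard c _) = classColour c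
  colourᵛ (entry k)   = side k
  colourᵛ (inner k u) = Digraph.colour (Ds k) u

  innerArc : ∀ k (u : Fin (ns k)) k′ (u′ : Fin (ns k′)) → Dec (k ≡ k′) → Bool
  innerArc k u .k u′ (yes refl) = Digraph.arc (Ds k) u u′
  innerArc _ _ _  _  (no _)     = true

  arcᵛ : Vertex → Vertex → Bool
  arcᵛ (guard c _) (guard c′ _)  = kills c c′
  arcᵛ (guard _ _) _             = true
  arcᵛ (entry k)   (inner k′ _)  = not (does (k ≟ k′))
  arcᵛ (entry _)   _             = true
  arcᵛ (inner k u) (guard c _)   = innerKills (Digraph.colour (Ds k) u) c
  arcᵛ (inner k u) (inner k′ u′) = innerArc k u k′ u′ (k ≟ k′)
  arcᵛ (inner _ _) (entry _)     = true

  open Enumerated enumeration arcᵛ colourᵛ public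

  Start : Remaining digraph
  Start _ = true

  after : Vertex → Remaining digraph
  after x = delete digraph Start (index x)

  game : Game
  game = digraphGame digraph

  after-entry-≋ : ∀ k → Fuelled (_≋ digraphGame (Ds k)) (after (entry k))
  after-entry-≋ k kD c = E.position-≋ kD (ns k) c (count≤n _) image
    where
    innerAt : Fin (ns k) → Fin _
    innerAt u = index (inner k u)

    innerAt-arc : ∀ u u′ → Digraph.arc digraph (innerAt u) (innerAt u′) ≡ Digraph.arc (Ds k) u u′
    innerAt-arc u u′ rewrite arc-index (inner k u) (inner k u′) with k ≟ k
    ... | yes refl = refl
    ... | no k≢k   = ⊥-elim (k≢k refl)

    innerAt-injective : ∀ {u u′} → innerAt u ≡ innerAt u′ → u ≡ u′
    innerAt-injective {u} {u′} e with index-injective {inner k u} {inner k u′} e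
    ... | refl = refl

    module E = Embedding digraph (Ds k) innerAt innerAt-injective (λ u → colour-index (inner k u)) innerAt-arc

    entry-spares-own : ∀ u → arcᵛ (entry k) (inner k u) ≡ false
    entry-spares-own u with k ≟ k
    ... | yes _  = refl
    ... | no k≢k = ⊥-elim (k≢k refl)

    only-own : ∀ y → arcᵛ (entry k) y ≡ false → ∃[ u ] innerAt u ≡ index y
    only-own (inner k′ u) spared with k ≟ k′
    ... | yes refl = u , refl
    only-own (guard _ _) ()
    only-own (entry _)   ()

    image : E.IsImage (λ _ → true) (after (entry k))
    image = record
      { agrees  = λ u → deleteᵛ⁺ Start (entry k) (inner k u) refl (λ ()) (entry-spares-own u)
      ; inImage = ∀-index _ (λ y survives → only-own y (proj₂ (deleteᵛ⁻ Start (entry k) y survives)))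
      }

  restOfClass : ∀ S c → (∀ t → S (index (guard c t)) ≡ true) →
                IndependentIn (delete digraph S (index (guard c Fin.zero))) K
  restOfClass S c inS = record
    { vertex    = λ t → index (guard c (Fin.suc t))
    ; injective = λ e → guard-injective (index-injective e)
    ; remains   = λ t → deleteᵛ⁺ S (guard c Fin.zero) (guard c (Fin.suc t)) (inS (Fin.suc t)) (λ ())
                                      (kills-irrefl c)
    ; noArc     = λ t t′ → trans (arc-index (guard c (Fin.suc t)) (guard c (Fin.suc t′))) (kills-irrefl c)
    }
    where
    guard-injective : ∀ {t t′} → guard c (Fin.suc t) ≡ guard c (Fin.suc t′) → t ≡ t′
    guard-injective refl = refl

  module _ (X : Game) (X≤K : size X ≤ K) where

    -- Right answers x by the first guard of class c; the survivors are guards spared by both x and c,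
    -- among them K independent ones of class c.
    punishedByRight : ∀ x c → classColour c ≡ red → (∀ t → guard c t ≢ x) → (∀ t → arcᵛ x (guard c t) ≡ false) →
                      (∀ c′ t → arcᵛ x (guard c′ t) ≡ false → kills c c′ ≡ false → classColour c′ ≡ red) →
                      Fuelled (_⧏ X) (after x)
    punishedByRight x c c-red fresh spared onlyRed =
      rightMove-⧏ (index (guard c Fin.zero))
                  (classInAfter Fin.zero , trans (colour-index (guard c Fin.zero)) c-red)
                  (onlyRed-≼ X X≤K (restOfClass (after x) c classInAfter) (∀-index _ survivorRed))
      where
      classInAfter : ∀ t → after x (index (guard c t)) ≡ true
      classInAfter t = deleteᵛ⁺ Start x (guard c t) refl (fresh t) (spared t)

      survivor : ∀ y → arcᵛ x y ≡ false → arcᵛ (guard c Fin.zero) y ≡ false → colourᵛ y ≡ red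
      survivor (guard c′ t) xy cy = onlyRed c′ t xy cy
      survivor (entry _)   _  ()
      survivor (inner _ _) _  ()

      survivorRed : ∀ y → delete digraph (after x) (index (guard c Fin.zero)) (index y) ≡ true →
                    Digraph.colour digraph (index y) ≡ red
      survivorRed y survives with deleteᵛ⁻ (after x) (guard c Fin.zero) y survives
      ... | inAfter , cy = trans (colour-index y) (survivor y (proj₂ (deleteᵛ⁻ Start x y inAfter)) cy)

    punishedByLeft : ∀ x c → classColour c ≡ blue → (∀ t → guard c t ≢ x) → (∀ t → arcᵛ x (guard c t) ≡ false) →
                     (∀ c′ t → arcᵛ x (guard c′ t) ≡ false → kills c c′ ≡ false → classColour c′ ≡ blue) →
                     Fuelled (X ⧏_) (after x)
    punishedByLeft x c c-blue fresh spared onlyBlue =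
      leftMove-⧏ (index (guard c Fin.zero))
                 (classInAfter Fin.zero , trans (colour-index (guard c Fin.zero)) c-blue)
                 (onlyBlue-≽ X X≤K (restOfClass (after x) c classInAfter) (∀-index _ survivorBlue))
      where
      classInAfter : ∀ t → after x (index (guard c t)) ≡ true
      classInAfter t = deleteᵛ⁺ Start x (guard c t) refl (fresh t) (spared t)

      survivor : ∀ y → arcᵛ x y ≡ false → arcᵛ (guard c Fin.zero) y ≡ false → colourᵛ y ≡ blue
      survivor (guard c′ t) xy cy = onlyBlue c′ t xy cy
      survivor (entry _)   _  ()
      survivor (inner _ _) _  ()

      survivorBlue : ∀ y → delete digraph (after x) (index (guard c Fin.zero)) (index y) ≡ true →
                     Digraph.colour digraph (index y) ≡ blue
      survivorBlue y survives with deleteᵛ⁻ (after x) (guard c Fin.zero) y survives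
      ... | inAfter , cy = trans (colour-index y) (survivor y (proj₂ (deleteᵛ⁻ Start x y inAfter)) cy)

    ≼-fromEntries : (∀ k → side k ≡ blue → Fuelled (_⧏ X) (after (entry k))) →
                    (∀ j → Fuelled (_⧏ gR X j) Start) → game ≼ X
    ≼-fromEntries leftEntry right = ≼-byMoves (∀-index _ leftMove) right _ (count≤n Start)
      where
      blueMove : ∀ x → colourᵛ x ≡ blue → Fuelled (_⧏ X) (after x)
      blueMove (guard g₁ t) _ = punishedByRight (guard g₁ t) g₀ refl (λ _ ()) (λ _ → refl)
        λ { g₀ _ _ _ → refl ; g₁ _ _ () ; g₂ _ () _ ; g₃ _ () _ }
      blueMove (guard g₃ t) _ = punishedByRight (guard g₃ t) g₂ refl (λ _ ()) (λ _ → refl)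
        λ { g₀ _ () _ ; g₁ _ () _ ; g₂ _ _ _ → refl ; g₃ _ _ () }
      blueMove (inner k u) u-blue = punishedByRight (inner k u) g₀ refl (λ _ ()) (λ _ → spares g₀)
        λ c′ _ xc′ _ → cong classColour (innerKills-blue c′ (trans (sym (spares c′)) xc′))
        where
        spares : ∀ c′ → innerKills (Digraph.colour (Ds k) u) c′ ≡ innerKills blue c′
        spares c′ = cong (λ col → innerKills col c′) u-blue
      blueMove (entry k) k-blue = leftEntry k k-blue
      blueMove (guard g₀ _) ()
      blueMove (guard g₂ _) ()

      leftMove : ∀ x → BlueIn Start (index x) → Fuelled (_⧏ X) (after x)
      leftMove x (_ , x-blue) = blueMove x (trans (sym (colour-index x)) x-blue)

    ≽-fromEntries : (∀ i → Fuelled (gL X i ⧏_) Start) →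
                    (∀ k → side k ≡ red → Fuelled (X ⧏_) (after (entry k))) → X ≼ game
    ≽-fromEntries left rightEntry = ≽-byMoves left (∀-index _ rightMove) _ (count≤n Start)
      where
      redMove : ∀ x → colourᵛ x ≡ red → Fuelled (X ⧏_) (after x)
      redMove (guard g₀ t) _ = punishedByLeft (guard g₀ t) g₃ refl (λ _ ()) (λ _ → refl)
        λ { g₀ _ _ () ; g₁ _ () _ ; g₂ _ () _ ; g₃ _ _ _ → refl }
      redMove (guard g₂ t) _ = punishedByLeft (guard g₂ t) g₁ refl (λ _ ()) (λ _ → refl)
        λ { g₀ _ () _ ; g₁ _ _ _ → refl ; g₂ _ _ () ; g₃ _ () _ }
      redMove (inner k u) u-red = punishedByLeft (inner k u) g₃ refl (λ _ ()) (λ _ → spares g₃)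
        λ c′ _ xc′ _ → cong classColour (innerKills-red c′ (trans (sym (spares c′)) xc′))
        where
        spares : ∀ c′ → innerKills (Digraph.colour (Ds k) u) c′ ≡ innerKills red c′
        spares c′ = cong (λ col → innerKills col c′) u-red
      redMove (entry k) k-red = rightEntry k k-red
      redMove (guard g₁ _) ()
      redMove (guard g₃ _) ()

      rightMove : ∀ x → RedIn Start (index x) → Fuelled (X ⧏_) (after x)
      rightMove x (_ , x-red) = redMove x (trans (sym (colour-index x)) x-red)

Realisation : Game → Set
Realisation G = Σ[ D ∈ Digraph ] digraphGame D ≋ G

module Step {nl nr : ℕ} (gl : Fin nl → Game) (gr : Fin nr → Game)
            (realiseL : ∀ i → Realisation (gl i)) (realiseR : ∀ j → Realisation (gr j)) where
  X : Game
  X = mk nl gl nr gr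

  sideOf : Fin nl ⊎ Fin nr → Colour
  sideOf (inj₁ _) = blue
  sideOf (inj₂ _) = red

  optionOf : Fin nl ⊎ Fin nr → Game
  optionOf (inj₁ i) = gl i
  optionOf (inj₂ j) = gr j

  realiseOf : ∀ s → Realisation (optionOf s)
  realiseOf (inj₁ i) = realiseL i
  realiseOf (inj₂ j) = realiseR j

  leftOption-⧏ : ∀ {G} s → sideOf s ≡ blue → G ≼ optionOf s → G ⧏ X
  leftOption-⧏ (inj₁ i) _ = lfL i
  leftOption-⧏ (inj₂ _) ()

  rightOption-⧏ : ∀ {G} s → sideOf s ≡ red → optionOf s ≼ G → X ⧏ G
  rightOption-⧏ (inj₁ _) ()
  rightOption-⧏ (inj₂ j) _ = lfR j

  open Construction (λ k → sideOf (splitAt nl k)) (λ k → proj₁ (realiseOf (splitAt nl k))) (size X)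

  after-entry-≋option : ∀ k → Fuelled (_≋ optionOf (splitAt nl k)) (after (entry k))
  after-entry-≋option k k′ c = ≋-trans (after-entry-≋ k k′ c) (proj₂ (realiseOf (splitAt nl k)))

  after-leftEntry-≋ : ∀ i → Fuelled (_≋ gl i) (after (entry (i ↑ˡ nr)))
  after-leftEntry-≋ i k′ c = subst (position digraph k′ (after (entry (i ↑ˡ nr))) ≋_)
                                   (cong optionOf (splitAt-↑ˡ nl i nr)) (after-entry-≋option (i ↑ˡ nr) k′ c)

  after-rightEntry-≋ : ∀ j → Fuelled (_≋ gr j) (after (entry (nl ↑ʳ j)))
  after-rightEntry-≋ j k′ c = subst (position digraph k′ (after (entry (nl ↑ʳ j))) ≋_)
                                    (cong optionOf (splitAt-↑ʳ nl nr j)) (after-entry-≋option (nl ↑ʳ j) k′ c)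

  realisation : Realisation X
  realisation = digraph , (game-≼ , game-≽)
    where
    game-≼ : game ≼ X
    game-≼ = ≼-fromEntries X ≤-refl
      (λ k k-blue k′ c → leftOption-⧏ (splitAt nl k) k-blue (proj₁ (after-entry-≋option k k′ c)))
      (λ j → rightMove-⧏ (index (entry (nl ↑ʳ j)))
               (refl , trans (colour-index (entry (nl ↑ʳ j))) (cong sideOf (splitAt-↑ʳ nl nr j)))
               (λ k′ c → proj₁ (after-rightEntry-≋ j k′ c)))

    game-≽ : X ≼ game
    game-≽ = ≽-fromEntries X ≤-refl
      (λ i → leftMove-⧏ (index (entry (i ↑ˡ nr)))
               (refl , trans (colour-index (entry (i ↑ˡ nr))) (cong sideOf (splitAt-↑ˡ nl i nr)))
               (λ k′ c → proj₂ (after-leftEntry-≋ i k′ c)))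
      (λ k k-red k′ c → rightOption-⧏ (splitAt nl k) k-red (proj₂ (after-entry-≋option k k′ c)))

realise : (X : Game) → Realisation X
realise (mk _ gl _ gr) = Step.realisation gl gr (λ i → realise (gl i)) (λ j → realise (gr j))

theorem7 : (X : Game) → Σ[ D ∈ Digraph ] (digraphGame D ≈g X)
theorem7 X with realise X
... | D , D≋X = D , ≋⇒≈g D≋X
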